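{- Let $v,k,t,\lambda$ be integers with $t\ge1$, let $A_1$ be the adjacency matrix of a strongly regular digraph with parameter set $(v,k,t,\lambda,t)$, and put $s=t-\lambda$. Suppose $0$-$1$ matrices $B_1$ ($v\times 4t$) and $C_1$ ($4t\times v$) satisfy $$B_1C_1=tJ_v,\quad B_1P_1=tJ_{v,4t},\quad P_1C_1=tJ_{4t,v},\quad A_1B_1+sB_1=tJ_{v,4t},\quad C_1A_1+sC_1=tJ_{4t,v},\quad C_1B_1+sP_1=tJ_{4t},$$ $$B_1J_{4t}=2tJ_{v,4t},\quad J_vB_1=kJ_{v,4t},\quad C_1J_v=kJ_{4t,v},\quad J_{4t}C_1=2tJ_{4t,v},$$ and the blockiness conditions: (i) if any row of $B_1$ is split into its first $2t$ and last $2t$ entries, exactly one of these two blocks consists entirely of ones and the other entirely of zeros; (ii) if any column of $C_1$ is split into its first $2t$ and last $2t$ entries, each block contains exactly $t$ ones. For $n\ge2$ define $$B_n=\begin{pmatrix} K_2\otimes B_{n-1}\otimes J_{1,2}\\ I_2\otimes P_{n-1}\otimes J_{1,2}\end{pmatrix},\qquad C_n=\begin{pmatrix} J_{2^n,1}\otimes I_2\otimes \alpha_{2^{n-1}}(C_{n-1}) & J_{2^n,1}\otimes I_2\otimes \alpha_{2^{n-1}}(P_{n-1})\end{pmatrix}.$$ Then for every $n\ge1$: (1) each row of $B_n$ contains exactly $t\cdot 2^n$ ones; (2) each column of $B_n$ contains exactly $k+(2^n-2)t$ ones; (3) each row of $C_n$ contains exactly $k+(2^n-2)t$ ones; (4)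 each column of $C_n$ contains exactly $t\cdot 2^n$ ones.
   Context: A strongly regular digraph with parameter set $(v,k,t,\lambda,\mu)$ is a digraph (no loops, no multiple edges in the same direction) on $v$ vertices whose $0$-$1$ adjacency matrix $A$ ($A(i,j)=1$ iff there is an edge $i\to j$) satisfies $A^2=tI_v+\lambda A+\mu(J_v-I_v-A)$ and $AJ_v=J_vA=kJ_v$. Notation: $I_m$ identity of order $m$; $J_m$ all-ones square matrix of order $m$; $J_{m,l}$ all-ones $m\times l$ matrix; $K_m$ the $m\times m$ exchange matrix with $K_m(i,j)=1$ iff $i+j=m+1$; $\otimes$ the Kronecker product. For $n\ge1$, $P_n=J_{2^n,1}\otimes K_{2^n}\otimes J_{t,t\cdot 2^n}$ (order $t\cdot4^n$). For an $m\times l$ matrix $X$ and $s'$ dividing $m$, $\alpha_{s'}(X)$ is the matrix formed by the first $m/s'$ rows of $X$. -}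

module Defs where

open import Data.Nat as ℕ using (ℕ; zero; suc; _^_; _≤_)
import Data.Nat.Properties as ℕP
open import Data.Integer as ℤ using (ℤ; +_)
open import Data.Fin as Fin using (Fin; toℕ; splitAt; remQuot; inject≤)
open import Data.Product using (_×_; _,_; proj₁; proj₂)
open import Data.Sum using (_⊎_; inj₁; inj₂; [_,_])
open import Data.Bool using (Bool; true; false; _∧_; if_then_else_)
open import Relation.Nullary.Decidable using (⌊_⌋)
open import Relation.Binary.PropositionalEquality using (_≡_; refl; sym; trans; cong; subst)
open import Data.Nat.Solver using (module +-*-Solver)
open +-*-Solver

Mat : ℕ → ℕ → Set
Mat m n = Fin m → Fin n → ℤ

_≐_ : ∀ {m n} → Mat m n → Mat m n → Set
A ≐ B = ∀ i j → A i j ≡ B i j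
infix 4 _≐_

∑ : ∀ {n} → (Fin n → ℤ) → ℤ
∑ {zero} f = + 0
∑ {suc n} f = f Fin.zero ℤ.+ ∑ (λ i → f (Fin.suc i))

count : ∀ {n} → (Fin n → Bool) → ℕ
count {zero} p = 0
count {suc n} p = (if p Fin.zero then 1 else 0) ℕ.+ count (λ i → p (Fin.suc i))

isOne : ℤ → Bool
isOne x = ⌊ x ℤ.≟ + 1 ⌋

Is01 : ∀ {m n} → Mat m n → Set
Is01 A = ∀ i j → (A i j ≡ + 0) ⊎ (A i j ≡ + 1)

onesInRow : ∀ {m n} → Mat m n → Fin m → ℕ
onesInRow A i = count (λ j → isOne (A i j))

onesInCol : ∀ {m n} → Mat m n → Fin n → ℕ
onesInCol A j = count (λ i → isOne (A i j))

J : ∀ m n → Mat m n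
J m n i j = + 1

I : ∀ m → Mat m m
I m i j = if ⌊ i Fin.≟ j ⌋ then + 1 else + 0

Zero : ∀ m n → Mat m n
Zero m n i j = + 0

-- exchange matrix K_m : K(i,j)=1 iff i+j = m+1 (1-based), i.e. i+j+1 = m (0-based)
K : ∀ m → Mat m m
K m i j = if ⌊ suc (toℕ i ℕ.+ toℕ j) ℕ.≟ m ⌋ then + 1 else + 0

_⊕_ : ∀ {m n} → Mat m n → Mat m n → Mat m n
(A ⊕ B) i j = A i j ℤ.+ B i j
infixl 6 _⊕_

_⊖_ : ∀ {m n} → Mat m n → Mat m n → Mat m n
(A ⊖ B) i j = A i j ℤ.- B i j
infixl 6 _⊖_

_·_ : ∀ {m n} → ℤ → Mat m n → Mat m n
(c · A) i j = c ℤ.* A i j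
infixl 7 _·_

_⊛_ : ∀ {m n p} → Mat m n → Mat n p → Mat m p
(A ⊛ B) i j = ∑ (λ l → A i l ℤ.* B l j)
infixl 8 _⊛_

-- Kronecker product; row index of A ⊗ B is (i₁,i₂) ↦ i₁·p + i₂
_⊗_ : ∀ {m n p q} → Mat m n → Mat p q → Mat (m ℕ.* p) (n ℕ.* q)
_⊗_ {m} {n} {p} {q} A B r c =
  A (proj₁ (remQuot {m} p r)) (proj₁ (remQuot {n} q c)) ℤ.* B (proj₂ (remQuot {m} p r)) (proj₂ (remQuot {n} q c))
infixl 9 _⊗_

vstack : ∀ {m p n} → Mat m n → Mat p n → Mat (m ℕ.+ p) n
vstack {m} A B i j = [ (λ i' → A i' j) , (λ i' → B i' j) ] (splitAt m i)

hstack : ∀ {m n q} → Mat m n → Mat m q → Mat m (n ℕ.+ q)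
hstack {n = n} A B i j = [ (λ j' → A i j') , (λ j' → B i j') ] (splitAt n j)

castMat : ∀ {m n m' n'} → m ≡ m' → n ≡ n' → Mat m n → Mat m' n'
castMat p q A i j = A (Fin.cast (sym p) i) (Fin.cast (sym q) j)

-- α_{s'}(X): the first m/s' rows of X (here d = m/s', witnessed by d·s' = m)
α : ∀ {m n} (s' d : ℕ) .{{_ : ℕ.NonZero s'}} → d ℕ.* s' ≡ m → Mat m n → Mat d n
α s' d eq X i j = X (inject≤ i (subst (d ≤_) eq (ℕP.m≤m*n d s'))) j

record IsSRD (v : ℕ) (k t lam μ : ℤ) (A : Mat v v) : Set where
  field
    zero-one : Is01 A
    no-loops : ∀ i → A i i ≡ + 0
    square   : A ⊛ A ≐ (t · I v) ⊕ (lam · A) ⊕ (μ · (J v v ⊖ I v ⊖ A))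
    rowReg   : A ⊛ J v v ≐ k · J v v
    colReg   : J v v ⊛ A ≐ k · J v v

pow4 : ∀ n → 4 ^ n ≡ 2 ^ n ℕ.* 2 ^ n
pow4 zero = refl
pow4 (suc n) = trans (cong (4 ℕ.*_) (pow4 n)) (solve 1 (λ a → con 4 :* (a :* a) := (con 2 :* a) :* (con 2 :* a)) refl (2 ^ n))

P : (t n : ℕ) → Mat (t ℕ.* 4 ^ n) (t ℕ.* 4 ^ n)
P t n = castMat eqr eqc ((J (2 ^ n) 1 ⊗ K (2 ^ n)) ⊗ J t (t ℕ.* 2 ^ n))
  where
  eqr : (2 ^ n ℕ.* 2 ^ n) ℕ.* t ≡ t ℕ.* 4 ^ n
  eqr = trans (ℕP.*-comm _ t) (cong (t ℕ.*_) (sym (pow4 n)))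
  eqc : (1 ℕ.* 2 ^ n) ℕ.* (t ℕ.* 2 ^ n) ≡ t ℕ.* 4 ^ n
  eqc = trans (solve 2 (λ a t → (con 1 :* a) :* (t :* a) := t :* (a :* a)) refl (2 ^ n) t)
              (cong (t ℕ.*_) (sym (pow4 n)))

-- The recursive construction.  Level m here is the paper's index n = m+1:
-- B m = B_{m+1}, C m = C_{m+1}.

module Construction (v t : ℕ) (B₁ : Mat v (t ℕ.* 4 ^ 1)) (C₁ : Mat (t ℕ.* 4 ^ 1) v) where

  R : ℕ → ℕ
  R zero = v
  R (suc m) = 2 ℕ.* R m ℕ.+ 2 ℕ.* (t ℕ.* 4 ^ suc m)

  αeq : ∀ m → (t ℕ.* 2 ^ m) ℕ.* 2 ^ m ≡ t ℕ.* 4 ^ m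
  αeq m = trans (ℕP.*-assoc t _ _) (cong (t ℕ.*_) (sym (pow4 m)))

  B : (m : ℕ) → Mat (R m) (t ℕ.* 4 ^ suc m)
  B zero = B₁
  B (suc m) = castMat eqr eqc
    (vstack ((K 2 ⊗ B m) ⊗ J 1 2) ((I 2 ⊗ P t (suc m)) ⊗ J 1 2))
    where
    eqr : (2 ℕ.* R m) ℕ.* 1 ℕ.+ (2 ℕ.* (t ℕ.* 4 ^ suc m)) ℕ.* 1 ≡ R (suc m)
    eqr = solve 2 (λ r x → (con 2 :* r) :* con 1 :+ (con 2 :* x) :* con 1 := con 2 :* r :+ con 2 :* x) refl (R m) (t ℕ.* 4 ^ suc m)
    eqc : (2 ℕ.* (t ℕ.* 4 ^ suc m)) ℕ.* 2 ≡ t ℕ.* 4 ^ suc (suc m)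
    eqc = solve 2 (λ t a → (con 2 :* (t :* a)) :* con 2 := t :* (con 4 :* a)) refl t (4 ^ suc m)

  C : (m : ℕ) → Mat (t ℕ.* 4 ^ suc m) (R m)
  C zero = C₁
  C (suc m) = castMat eqr eqc
    (hstack ((J (2 ^ suc (suc m)) 1 ⊗ I 2) ⊗ α (2 ^ suc m) (t ℕ.* 2 ^ suc m) {{ℕP.m^n≢0 2 (suc m)}} (αeq (suc m)) (C m))
            ((J (2 ^ suc (suc m)) 1 ⊗ I 2) ⊗ α (2 ^ suc m) (t ℕ.* 2 ^ suc m) {{ℕP.m^n≢0 2 (suc m)}} (αeq (suc m)) (P t (suc m))))
    where
    eqr : (2 ^ suc (suc m) ℕ.* 2) ℕ.* (t ℕ.* 2 ^ suc m) ≡ t ℕ.* 4 ^ suc (suc m)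
    eqr = trans (solve 2 (λ b t → ((con 2 :* b) :* con 2) :* (t :* b) := t :* (con 4 :* (b :* b))) refl (2 ^ suc m) t)
                (cong (λ z → t ℕ.* (4 ℕ.* z)) (sym (pow4 (suc m))))
    eqc : (1 ℕ.* 2) ℕ.* R m ℕ.+ (1 ℕ.* 2) ℕ.* (t ℕ.* 4 ^ suc m) ≡ R (suc m)
    eqc = solve 2 (λ r x → (con 1 :* con 2) :* r :+ (con 1 :* con 2) :* x := con 2 :* r :+ con 2 :* x) refl (R m) (t ℕ.* 4 ^ suc m)

-- For 0-1 matrices the
-- number of ones in a row (column) is multiplicative under ⊗ and additive under
-- stacking, so the four counts obey simple recurrences: rows of B and columns of C
-- double, while columns of B and rows of C grow by t·2ⁿ. The one subtle step is α,
-- which keeps only the first t·2ⁿ rows of C_n and P_n: column counts of α(C_n) are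
-- the numbers of ones in the top part of the columns of C_n. The induction therefore
-- also carries "the top part of every column of C_n has exactly t ones", which is
-- hypothesis (ii) for n = 1 and is inherited from P_n and from the I₂ factor.
-- The base counts are read off from B₁J = 2tJ, JB₁ = kJ, C₁J = kJ and JC₁ = 2tJ.

module Submission where

open import Defs
open import Data.Nat as ℕ using (ℕ; zero; suc; _^_; _≤_; _<_; _<ᵇ_)
open import Data.Nat using () renaming (_*_ to _*ℕ_)
import Data.Nat.Properties as ℕP
open import Data.Nat.Tactic.RingSolver using (solve-∀)
open import Data.Integer as ℤ using (ℤ; +_; _+_; _-_; _*_)
import Data.Integer.Properties as ℤP
import Data.Integer.Tactic.RingSolver as ℤ-Solver
open import Data.Fin as Fin using (Fin; toℕ; splitAt; remQuot; inject≤; combine; cast; opposite; _↑ˡ_; _↑ʳ_)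
import Data.Fin.Properties as FP
open import Data.Product using (_×_; _,_; proj₁; proj₂)
open import Data.Sum using (_⊎_; inj₁; inj₂; [_,_])
open import Data.Bool using (Bool; true; false; _∧_; not; if_then_else_; T)
import Data.Bool.Properties as BP
open import Function using (_∘_)
open import Relation.Nullary.Decidable using (⌊_⌋; toWitness; fromWitness)
open import Data.Unit using (tt)
open import Data.Empty using (⊥-elim)
open import Relation.Nullary.Reflects using (fromEquivalence; det)
open import Relation.Binary.PropositionalEquality hiding (J; [_])

private
  variable
    m n p q : ℕ

-- Counting

bit : Bool → ℕ
bit b = if b then 1 else 0

count-cong : {f g : Fin n → Bool} → (∀ i → f i ≡ g i) → count f ≡ count g
count-cong {zero}  f≗g = refl
count-cong {suc n} f≗g = cong₂ (λ b c → bit b ℕ.+ c) (f≗g Fin.zero) (count-cong (f≗g ∘ Fin.suc))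

count-true : count {n} (λ _ → true) ≡ n
count-true {zero}  = refl
count-true {suc n} = cong suc count-true

count-false : {f : Fin n → Bool} → (∀ i → f i ≡ false) → count f ≡ 0
count-false {zero}  f≗false = refl
count-false {suc n} f≗false rewrite f≗false Fin.zero = count-false (f≗false ∘ Fin.suc)

count-↑ : ∀ m (f : Fin (m ℕ.+ n) → Bool) →
          count f ≡ count (f ∘ (_↑ˡ n)) ℕ.+ count (f ∘ (m ↑ʳ_))
count-↑ zero    f = refl
count-↑ (suc m) f = trans (cong (bit (f Fin.zero) ℕ.+_) (count-↑ m (f ∘ Fin.suc)))
                          (sym (ℕP.+-assoc (bit (f Fin.zero)) _ _))

count-cast : .(eq : m ≡ n) (f : Fin n → Bool) → count (f ∘ cast eq) ≡ count f
count-cast {zero}  {zero}  eq f = refl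
count-cast {suc m} {suc n} eq f =
  cong (bit (f Fin.zero) ℕ.+_) (count-cast {m} {n} (cong ℕ.pred eq) (f ∘ Fin.suc))

count-unique : (f : Fin n → Bool) (i : Fin n) → T (f i) → (∀ j → T (f j) → j ≡ i) → count f ≡ 1
count-unique {suc n} f Fin.zero fi unique with f Fin.zero
... | false = ⊥-elim fi
... | true  = cong suc (count-false others)
  where
  others : ∀ j → f (Fin.suc j) ≡ false
  others j with f (Fin.suc j) in fj
  ... | false = refl
  ... | true  with () ← unique (Fin.suc j) (subst T (sym fj) tt)
count-unique {suc n} f (Fin.suc i) fi unique with f Fin.zero in f0
... | true  with () ← unique Fin.zero (subst T (sym f0) tt)
... | false = count-unique (f ∘ Fin.suc) i fi (λ j fj → FP.suc-injective (unique (Fin.suc j) fj))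

count-∧ : (b : Bool) (f : Fin n → Bool) → count (λ i → b ∧ f i) ≡ bit b ℕ.* count f
count-∧ true  f = sym (ℕP.+-identityʳ (count f))
count-∧ {n} false f = count-false {n} (λ _ → refl)

count-combine : (f : Fin (m ℕ.* n) → Bool) (g : Fin m → Bool) (h : Fin n → Bool) →
                (∀ i j → f (combine i j) ≡ g i ∧ h j) → count f ≡ count g ℕ.* count h
count-combine {zero}          f g h f≗g∧h = refl
count-combine {suc m} {n} f g h f≗g∧h = begin
  count f
    ≡⟨ count-↑ n f ⟩
  count (f ∘ (_↑ˡ m ℕ.* n)) ℕ.+ count (f ∘ (n ↑ʳ_))
    ≡⟨ cong₂ ℕ._+_ (trans (count-cong (f≗g∧h Fin.zero)) (count-∧ (g Fin.zero) h))
                   (count-combine (f ∘ (n ↑ʳ_)) (g ∘ Fin.suc) h (f≗g∧h ∘ Fin.suc)) ⟩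
  bit (g Fin.zero) ℕ.* count h ℕ.+ count (g ∘ Fin.suc) ℕ.* count h
    ≡⟨ ℕP.*-distribʳ-+ (count h) (bit (g Fin.zero)) _ ⟨
  count g ℕ.* count h ∎
  where open ≡-Reasoning

count-inject≤ : (le : m ≤ n) (f : Fin n → Bool) →
                count (f ∘ (λ i → inject≤ i le)) ≡ count (λ i → (toℕ i <ᵇ m) ∧ f i)
count-inject≤ {zero} {n} le     f = sym (count-false {n} (λ _ → refl))
count-inject≤ {suc m} (ℕ.s≤s le) f = cong (bit (f Fin.zero) ℕ.+_) (count-inject≤ le (f ∘ Fin.suc))

Bit : ℤ → Set
Bit x = (x ≡ + 0) ⊎ (x ≡ + 1)

isOne-*-bitˡ : ∀ {x} y → Bit x → isOne (x * y) ≡ isOne x ∧ isOne y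
isOne-*-bitˡ y (inj₁ refl) = cong isOne (ℤP.*-zeroˡ y)
isOne-*-bitˡ y (inj₂ refl) = cong isOne (ℤP.*-identityˡ y)

isOne-*-bitʳ : ∀ x {y} → Bit y → isOne (x * y) ≡ isOne x ∧ isOne y
isOne-*-bitʳ x (inj₁ refl) = trans (cong isOne (ℤP.*-zeroʳ x)) (sym (BP.∧-zeroʳ (isOne x)))
isOne-*-bitʳ x (inj₂ refl) = trans (cong isOne (ℤP.*-identityʳ x)) (sym (BP.∧-identityʳ (isOne x)))

Bit-* : ∀ {x y} → Bit x → Bit y → Bit (x * y)
Bit-* (inj₁ refl) _           = inj₁ refl
Bit-* (inj₂ refl) (inj₁ refl) = inj₁ refl
Bit-* (inj₂ refl) (inj₂ refl) = inj₂ refl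

isOne-if : ∀ b → isOne (if b then + 1 else + 0) ≡ b
isOne-if true  = refl
isOne-if false = refl

Bit-if : ∀ b → Bit (if b then + 1 else + 0)
Bit-if true  = inj₂ refl
Bit-if false = inj₁ refl

∑-bits : (f : Fin n → ℤ) → (∀ i → Bit (f i)) → ∑ f ≡ + count (isOne ∘ f)
∑-bits {zero}  f bits = refl
∑-bits {suc n} f bits with bits Fin.zero
... | inj₁ f0≡0 rewrite f0≡0 = trans (ℤP.+-identityˡ _) (∑-bits (f ∘ Fin.suc) (bits ∘ Fin.suc))
... | inj₂ f0≡1 rewrite f0≡1 = cong (λ s → + 1 + s) (∑-bits (f ∘ Fin.suc) (bits ∘ Fin.suc))

∑-cong : {f g : Fin n → ℤ} → (∀ i → f i ≡ g i) → ∑ f ≡ ∑ g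
∑-cong {zero}  f≗g = refl
∑-cong {suc n} f≗g = cong₂ _+_ (f≗g Fin.zero) (∑-cong (f≗g ∘ Fin.suc))

J-01 : Is01 (J m n)
J-01 i j = inj₂ refl

I-01 : Is01 (I m)
I-01 i j = Bit-if _

K-01 : Is01 (K m)
K-01 i j = Bit-if _

⊗-combine : (A : Mat m n) (B : Mat p q) (i : Fin m) (k : Fin p) (j : Fin n) (l : Fin q) →
            (A ⊗ B) (combine i k) (combine j l) ≡ A i j * B k l
⊗-combine A B i k j l =
  cong₂ (λ r c → A (proj₁ r) (proj₁ c) * B (proj₂ r) (proj₂ c))
        (FP.remQuot-combine i k) (FP.remQuot-combine j l)

⊗-01 : (A : Mat m n) (B : Mat p q) → Is01 A → Is01 B → Is01 (A ⊗ B)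
⊗-01 A B A01 B01 r c = Bit-* (A01 _ _) (B01 _ _)

-- One factor must be 0-1: isOne (x * y) ≡ isOne x ∧ isOne y fails for x = y = -1.
isOne-⊗ : (A : Mat m n) (B : Mat p q) → Is01 A ⊎ Is01 B → ∀ i k j l →
          isOne ((A ⊗ B) (combine i k) (combine j l)) ≡ isOne (A i j) ∧ isOne (B k l)
isOne-⊗ A B bits i k j l = trans (cong isOne (⊗-combine A B i k j l)) (isOne-* bits)
  where
  isOne-* : Is01 A ⊎ Is01 B → isOne (A i j * B k l) ≡ isOne (A i j) ∧ isOne (B k l)
  isOne-* (inj₁ A01) = isOne-*-bitˡ (B k l) (A01 i j)
  isOne-* (inj₂ B01) = isOne-*-bitʳ (A i j) (B01 k l)

-- Matrices with a constant number of ones per row or column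

record RowOnes (A : Mat m n) (a : ℕ) : Set where
  constructor rowOnes
  field onesInRow≡ : ∀ i → onesInRow A i ≡ a

record ColOnes (A : Mat m n) (a : ℕ) : Set where
  constructor colOnes
  field onesInCol≡ : ∀ j → onesInCol A j ≡ a

onesInTop : ℕ → Mat m n → Fin n → ℕ
onesInTop d A j = count (λ i → (toℕ i <ᵇ d) ∧ isOne (A i j))

record TopColOnes (d : ℕ) (A : Mat m n) (a : ℕ) : Set where
  constructor topColOnes
  field onesInTop≡ : ∀ j → onesInTop d A j ≡ a

open RowOnes
open ColOnes
open TopColOnes

combine-<ᵇ : ∀ s (i : Fin m) (k : Fin p) → (toℕ (combine i k) <ᵇ s ℕ.* p) ≡ (toℕ i <ᵇ s)
combine-<ᵇ {p = p} s i k = det (fromEquivalence (from ∘ ℕP.<ᵇ⇒< _ _) (ℕP.<⇒<ᵇ ∘ to))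
                               (ℕP.<ᵇ-reflects-< (toℕ i) s)
  where
  open ℕP.≤-Reasoning
  to : toℕ i < s → toℕ (combine i k) < s ℕ.* p
  to i<s = begin-strict
    toℕ (combine i k)        ≡⟨ FP.toℕ-combine i k ⟩
    p ℕ.* toℕ i ℕ.+ toℕ k    <⟨ ℕP.+-monoʳ-< (p ℕ.* toℕ i) (FP.toℕ<n k) ⟩
    p ℕ.* toℕ i ℕ.+ p        ≡⟨ ℕP.+-comm _ p ⟩
    p ℕ.+ p ℕ.* toℕ i        ≡⟨ ℕP.*-suc p (toℕ i) ⟨
    p ℕ.* suc (toℕ i)        ≤⟨ ℕP.*-monoʳ-≤ p i<s ⟩
    p ℕ.* s                  ≡⟨ ℕP.*-comm p s ⟩
    s ℕ.* p                  ∎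
  from : toℕ (combine i k) < s ℕ.* p → toℕ i < s
  from lt = ℕP.*-cancelʳ-< p (toℕ i) s (begin-strict
    toℕ i ℕ.* p              ≡⟨ ℕP.*-comm (toℕ i) p ⟩
    p ℕ.* toℕ i              ≤⟨ ℕP.m≤m+n _ (toℕ k) ⟩
    p ℕ.* toℕ i ℕ.+ toℕ k    ≡⟨ FP.toℕ-combine i k ⟨
    toℕ (combine i k)        <⟨ lt ⟩
    s ℕ.* p                  ∎)

module _ {A : Mat m n} {B : Mat p q} where

  RowOnes-⊗ : ∀ {a b} → RowOnes A a → RowOnes B b → Is01 A ⊎ Is01 B → RowOnes (A ⊗ B) (a ℕ.* b)
  RowOnes-⊗ (rowOnes rowsA) (rowOnes rowsB) bits = rowOnes rows
    where
    rows : ∀ r → onesInRow (A ⊗ B) r ≡ _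
    rows r = subst (λ r → onesInRow (A ⊗ B) r ≡ _) (FP.combine-remQuot {m} p r)
      (trans (count-combine _ (λ j → isOne (A i j)) (λ l → isOne (B k l)) (isOne-⊗ A B bits i k))
             (cong₂ ℕ._*_ (rowsA i) (rowsB k)))
      where
      i = proj₁ (remQuot {m} p r)
      k = proj₂ (remQuot {m} p r)

  ColOnes-⊗ : ∀ {a b} → ColOnes A a → ColOnes B b → Is01 A ⊎ Is01 B → ColOnes (A ⊗ B) (a ℕ.* b)
  ColOnes-⊗ (colOnes colsA) (colOnes colsB) bits = colOnes cols
    where
    cols : ∀ c → onesInCol (A ⊗ B) c ≡ _
    cols c = subst (λ c → onesInCol (A ⊗ B) c ≡ _) (FP.combine-remQuot {n} q c)
      (trans (count-combine _ (λ i → isOne (A i j)) (λ k → isOne (B k l)) (λ i k → isOne-⊗ A B bits i k j l))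
             (cong₂ ℕ._*_ (colsA j) (colsB l)))
      where
      j = proj₁ (remQuot {n} q c)
      l = proj₂ (remQuot {n} q c)

  TopColOnes-⊗ : ∀ s {d a b} → s ℕ.* p ≡ d → TopColOnes s A a → ColOnes B b → Is01 A ⊎ Is01 B →
                 TopColOnes d (A ⊗ B) (a ℕ.* b)
  TopColOnes-⊗ s refl (topColOnes topA) (colOnes colsB) bits = topColOnes tops
    where
    tops : ∀ c → onesInTop (s ℕ.* p) (A ⊗ B) c ≡ _
    tops c = subst (λ c → onesInTop (s ℕ.* p) (A ⊗ B) c ≡ _) (FP.combine-remQuot {n} q c)
      (trans (count-combine _ (λ i → (toℕ i <ᵇ s) ∧ isOne (A i j)) (λ k → isOne (B k l)) entry)
             (cong₂ ℕ._*_ (topA j) (colsB l)))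
      where
      j = proj₁ (remQuot {n} q c)
      l = proj₂ (remQuot {n} q c)
      entry : ∀ i k → (toℕ (combine i k) <ᵇ s ℕ.* p) ∧ isOne ((A ⊗ B) (combine i k) (combine j l))
                    ≡ ((toℕ i <ᵇ s) ∧ isOne (A i j)) ∧ isOne (B k l)
      entry i k = trans (cong₂ _∧_ (combine-<ᵇ s i k) (isOne-⊗ A B bits i k j l))
                        (sym (BP.∧-assoc (toℕ i <ᵇ s) _ _))

module _ {A : Mat m n} {B : Mat p n} where

  vstack-↑ˡ : ∀ i j → vstack A B (i ↑ˡ p) j ≡ A i j
  vstack-↑ˡ i j = cong [ (λ i′ → A i′ j) , (λ i′ → B i′ j) ] (FP.splitAt-↑ˡ m i p)

  vstack-↑ʳ : ∀ i j → vstack A B (m ↑ʳ i) j ≡ B i j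
  vstack-↑ʳ i j = cong [ (λ i′ → A i′ j) , (λ i′ → B i′ j) ] (FP.splitAt-↑ʳ m p i)

  RowOnes-vstack : ∀ {a} → RowOnes A a → RowOnes B a → RowOnes (vstack A B) a
  RowOnes-vstack (rowOnes rowsA) (rowOnes rowsB) = rowOnes rows
    where
    rows : ∀ i → onesInRow (vstack A B) i ≡ _
    rows i with splitAt m i
    ... | inj₁ i′ = rowsA i′
    ... | inj₂ i′ = rowsB i′

  ColOnes-vstack : ∀ {a b} → ColOnes A a → ColOnes B b → ColOnes (vstack A B) (a ℕ.+ b)
  ColOnes-vstack (colOnes colsA) (colOnes colsB) = colOnes λ j → trans (count-↑ m _) (cong₂ ℕ._+_
    (trans (count-cong (λ i → cong isOne (vstack-↑ˡ i j))) (colsA j))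
    (trans (count-cong (λ i → cong isOne (vstack-↑ʳ i j))) (colsB j)))

module _ {A : Mat m n} {B : Mat m q} where

  hstack-↑ˡ : ∀ i j → hstack A B i (j ↑ˡ q) ≡ A i j
  hstack-↑ˡ i j = cong [ (λ j′ → A i j′) , (λ j′ → B i j′) ] (FP.splitAt-↑ˡ n j q)

  hstack-↑ʳ : ∀ i j → hstack A B i (n ↑ʳ j) ≡ B i j
  hstack-↑ʳ i j = cong [ (λ j′ → A i j′) , (λ j′ → B i j′) ] (FP.splitAt-↑ʳ n q j)

  RowOnes-hstack : ∀ {a b} → RowOnes A a → RowOnes B b → RowOnes (hstack A B) (a ℕ.+ b)
  RowOnes-hstack (rowOnes rowsA) (rowOnes rowsB) = rowOnes λ i → trans (count-↑ n _) (cong₂ ℕ._+_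
    (trans (count-cong (λ j → cong isOne (hstack-↑ˡ i j))) (rowsA i))
    (trans (count-cong (λ j → cong isOne (hstack-↑ʳ i j))) (rowsB i)))

  ColOnes-hstack : ∀ {a} → ColOnes A a → ColOnes B a → ColOnes (hstack A B) a
  ColOnes-hstack (colOnes colsA) (colOnes colsB) = colOnes cols
    where
    cols : ∀ j → onesInCol (hstack A B) j ≡ _
    cols j with splitAt n j
    ... | inj₁ j′ = colsA j′
    ... | inj₂ j′ = colsB j′

  TopColOnes-hstack : ∀ d {a} → TopColOnes d A a → TopColOnes d B a → TopColOnes d (hstack A B) a
  TopColOnes-hstack d (topColOnes topA) (topColOnes topB) = topColOnes tops
    where
    tops : ∀ j → onesInTop d (hstack A B) j ≡ _
    tops j with splitAt n j
    ... | inj₁ j′ = topA j′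
    ... | inj₂ j′ = topB j′

module _ {m′ n′} (m≡m′ : m ≡ m′) (n≡n′ : n ≡ n′) {A : Mat m n} where

  RowOnes-cast : ∀ {a} → RowOnes A a → RowOnes (castMat m≡m′ n≡n′ A) a
  RowOnes-cast (rowOnes rowsA) = rowOnes λ i → trans (count-cast (sym n≡n′) _) (rowsA _)

  ColOnes-cast : ∀ {a} → ColOnes A a → ColOnes (castMat m≡m′ n≡n′ A) a
  ColOnes-cast (colOnes colsA) = colOnes λ j → trans (count-cast (sym m≡m′) _) (colsA _)

  TopColOnes-cast : ∀ d {a} → TopColOnes d A a → TopColOnes d (castMat m≡m′ n≡n′ A) a
  TopColOnes-cast d (topColOnes topA) = topColOnes λ j → trans
    (count-cong (λ i → cong (λ x → (x <ᵇ d) ∧ isOne (A (cast (sym m≡m′) i) (cast (sym n≡n′) j)))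
                            (sym (FP.toℕ-cast (sym m≡m′) i))))
    (trans (count-cast (sym m≡m′) (λ i → (toℕ i <ᵇ d) ∧ isOne (A i (cast (sym n≡n′) j)))) (topA _))

module _ (s d : ℕ) .{{_ : ℕ.NonZero s}} (ds≡m : d ℕ.* s ≡ m) {X : Mat m n} where

  RowOnes-α : ∀ {a} → RowOnes X a → RowOnes (α s d ds≡m X) a
  RowOnes-α (rowOnes rowsX) = rowOnes λ i → rowsX _

  ColOnes-α : ∀ {a} → TopColOnes d X a → ColOnes (α s d ds≡m X) a
  ColOnes-α (topColOnes topX) = colOnes λ j →
    trans (count-inject≤ (subst (d ≤_) ds≡m (ℕP.m≤m*n d s)) (λ i → isOne (X i j))) (topX j)

RowOnes-J : ∀ m n → RowOnes (J m n) n
RowOnes-J m n = rowOnes λ i → count-true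

ColOnes-J : ∀ m n → ColOnes (J m n) m
ColOnes-J m n = colOnes λ j → count-true

TopColOnes-J : ∀ m n → 0 < m → TopColOnes 1 (J m n) 1
TopColOnes-J (suc m) n _ = topColOnes λ j → cong suc (count-false {m} (λ _ → refl))

RowOnes-I : ∀ m → RowOnes (I m) 1
RowOnes-I m = rowOnes λ i → trans (count-cong {m} (λ j → isOne-if _))
  (count-unique (λ j → ⌊ i Fin.≟ j ⌋) i (fromWitness refl) (λ j i≡j → sym (toWitness i≡j)))

ColOnes-I : ∀ m → ColOnes (I m) 1
ColOnes-I m = colOnes λ j → trans (count-cong {m} (λ i → isOne-if _))
  (count-unique (λ i → ⌊ i Fin.≟ j ⌋) j (fromWitness refl) (λ i i≡j → toWitness i≡j))

K-sym : ∀ i j → K m i j ≡ K m j i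
K-sym {m} i j = cong (λ x → if ⌊ suc x ℕ.≟ m ⌋ then + 1 else + 0) (ℕP.+-comm (toℕ i) (toℕ j))

RowOnes-K : ∀ m → RowOnes (K m) 1
RowOnes-K m = rowOnes λ i → trans (count-cong {m} (λ j → isOne-if _))
  (count-unique (λ j → ⌊ suc (toℕ i ℕ.+ toℕ j) ℕ.≟ m ⌋) (opposite i) (fromWitness (opposite-fits i))
                (λ j fits → FP.toℕ-injective (unique i j (toWitness fits))))
  where
  opposite-fits : ∀ i → suc (toℕ i ℕ.+ toℕ (opposite i)) ≡ m
  opposite-fits i = trans (cong (λ x → suc (toℕ i ℕ.+ x)) (FP.opposite-prop i)) (ℕP.m+[n∸m]≡n (FP.toℕ<n i))
  unique : ∀ i j → suc (toℕ i ℕ.+ toℕ j) ≡ m → toℕ j ≡ toℕ (opposite i)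
  unique i j fits = trans (sym (ℕP.m+n∸m≡n (suc (toℕ i)) (toℕ j)))
                        (trans (cong (ℕ._∸ suc (toℕ i)) fits) (sym (FP.opposite-prop i)))

ColOnes-K : ∀ m → ColOnes (K m) 1
ColOnes-K m = colOnes λ j → trans (count-cong {m} (λ i → cong isOne (K-sym i j))) (onesInRow≡ (RowOnes-K m) j)

P-rows : ∀ t n → (2 ^ n ℕ.* 2 ^ n) ℕ.* t ≡ t ℕ.* 4 ^ n
P-rows t n = trans (ℕP.*-comm _ t) (cong (t ℕ.*_) (sym (pow4 n)))

P-cols : ∀ t n → (1 ℕ.* 2 ^ n) ℕ.* (t ℕ.* 2 ^ n) ≡ t ℕ.* 4 ^ n
P-cols t n = trans (shuffle (2 ^ n) t) (cong (t ℕ.*_) (sym (pow4 n)))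
  where
  shuffle : ∀ a t → (1 ℕ.* a) ℕ.* (t ℕ.* a) ≡ t ℕ.* (a ℕ.* a)
  shuffle = solve-∀

RowOnes-P : ∀ t n → RowOnes (P t n) (t ℕ.* 2 ^ n)
RowOnes-P t n = subst (RowOnes (P t n)) (ℕP.*-identityˡ (t ℕ.* 2 ^ n))
  (RowOnes-cast (P-rows t n) (P-cols t n)
    (RowOnes-⊗ (RowOnes-⊗ (RowOnes-J (2 ^ n) 1) (RowOnes-K (2 ^ n)) (inj₁ J-01))
               (RowOnes-J t (t ℕ.* 2 ^ n)) (inj₂ J-01)))

ColOnes-P : ∀ t n → ColOnes (P t n) (t ℕ.* 2 ^ n)
ColOnes-P t n = subst (ColOnes (P t n)) (swap (2 ^ n) t)
  (ColOnes-cast (P-rows t n) (P-cols t n)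
    (ColOnes-⊗ (ColOnes-⊗ (ColOnes-J (2 ^ n) 1) (ColOnes-K (2 ^ n)) (inj₁ J-01))
               (ColOnes-J t (t ℕ.* 2 ^ n)) (inj₂ J-01)))
  where
  swap : ∀ a t → (a ℕ.* 1) ℕ.* t ≡ t ℕ.* a
  swap = solve-∀

TopColOnes-P : ∀ t n → TopColOnes (t ℕ.* 2 ^ n) (P t n) t
TopColOnes-P t n = subst (TopColOnes (t ℕ.* 2 ^ n) (P t n)) (ℕP.*-identityˡ t)
  (TopColOnes-cast (P-rows t n) (P-cols t n) _
    (TopColOnes-⊗ (2 ^ n) (ℕP.*-comm (2 ^ n) t)
      (TopColOnes-⊗ 1 (ℕP.*-identityˡ (2 ^ n)) (TopColOnes-J (2 ^ n) 1 (ℕP.m^n>0 2 n))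
                    (ColOnes-K (2 ^ n)) (inj₁ J-01))
      (ColOnes-J t (t ℕ.* 2 ^ n)) (inj₂ J-01)))

onesInRow-⊛J : (A : Mat m n) → Is01 A → ∀ {z} → A ⊛ J n n ≐ z · J m n → Fin n →
               ∀ i → + onesInRow A i ≡ z
onesInRow-⊛J {n = n} A A01 {z} AJ≐zJ j₀ i = begin
  + onesInRow A i         ≡⟨ ∑-bits (A i) (A01 i) ⟨
  ∑ (A i)                 ≡⟨ ∑-cong (λ l → ℤP.*-identityʳ (A i l)) ⟨
  (A ⊛ J n n) i j₀        ≡⟨ AJ≐zJ i j₀ ⟩
  z * + 1                 ≡⟨ ℤP.*-identityʳ z ⟩
  z                       ∎
  where open ≡-Reasoning

onesInCol-J⊛ : (A : Mat m n) → Is01 A → ∀ {z} → J m m ⊛ A ≐ z · J m n → Fin m →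
               ∀ j → + onesInCol A j ≡ z
onesInCol-J⊛ {m} A A01 {z} JA≐zJ i₀ j = begin
  + onesInCol A j         ≡⟨ ∑-bits (λ l → A l j) (λ l → A01 l j) ⟨
  ∑ (λ l → A l j)         ≡⟨ ∑-cong (λ l → ℤP.*-identityˡ (A l j)) ⟨
  (J m m ⊛ A) i₀ j        ≡⟨ JA≐zJ i₀ j ⟩
  z * + 1                 ≡⟨ ℤP.*-identityʳ z ⟩
  z                       ∎
  where open ≡-Reasoning

-- For v = 0 the (0,0) entry of this identity reads 0 = t, since K₂ has zero diagonal.
someVertex : ∀ {v t} (s : ℤ) (C : Mat (t ℕ.* 4 ^ 1) v) (B : Mat v (t ℕ.* 4 ^ 1)) → 1 ≤ t →
             C ⊛ B ⊕ s · P t 1 ≐ + t · J (t ℕ.* 4 ^ 1) (t ℕ.* 4 ^ 1) → Fin v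
someVertex {suc v} _ _ _ _ _ = Fin.zero
someVertex {zero} {suc t} s C B _ CB+sP≐tJ
  with () ← trans (cong (λ x → + 0 + x) (sym (ℤP.*-zeroʳ s))) (CB+sP≐tJ Fin.zero Fin.zero)

module Growth (v t : ℕ) (B₁ : Mat v (t ℕ.* 4 ^ 1)) (C₁ : Mat (t ℕ.* 4 ^ 1) v) (c : ℕ) where

  open Construction v t B₁ C₁

  -- κ m = c + (2^(m+1) - 2)·t (see +κ), kept in ℕ to avoid subtraction.
  κ : ℕ → ℕ
  κ zero    = c
  κ (suc m) = κ m ℕ.+ t ℕ.* 2 ^ suc m

  private
    B-rows : ∀ m → (2 ℕ.* R m) ℕ.* 1 ℕ.+ (2 ℕ.* (t ℕ.* 4 ^ suc m)) ℕ.* 1 ≡ R (suc m)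
    B-rows m = shape (R m) (t ℕ.* 4 ^ suc m)
      where
      shape : ∀ r x → (2 ℕ.* r) ℕ.* 1 ℕ.+ (2 ℕ.* x) ℕ.* 1 ≡ 2 ℕ.* r ℕ.+ 2 ℕ.* x
      shape = solve-∀

    B-cols : ∀ m → (2 ℕ.* (t ℕ.* 4 ^ suc m)) ℕ.* 2 ≡ t ℕ.* 4 ^ suc (suc m)
    B-cols m = shape t (4 ^ suc m)
      where
      shape : ∀ t x → (2 ℕ.* (t ℕ.* x)) ℕ.* 2 ≡ t ℕ.* (4 ℕ.* x)
      shape = solve-∀

    C-rows : ∀ m → (2 ^ suc (suc m) ℕ.* 2) ℕ.* (t ℕ.* 2 ^ suc m) ≡ t ℕ.* 4 ^ suc (suc m)
    C-rows m = trans (shape (2 ^ suc m) t) (cong (λ x → t ℕ.* (4 ℕ.* x)) (sym (pow4 (suc m))))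
      where
      shape : ∀ b t → ((2 ℕ.* b) ℕ.* 2) ℕ.* (t ℕ.* b) ≡ t ℕ.* (4 ℕ.* (b ℕ.* b))
      shape = solve-∀

    C-cols : ∀ m → (1 ℕ.* 2) ℕ.* R m ℕ.+ (1 ℕ.* 2) ℕ.* (t ℕ.* 4 ^ suc m) ≡ R (suc m)
    C-cols m = shape (R m) (t ℕ.* 4 ^ suc m)
      where
      shape : ∀ r x → (1 ℕ.* 2) ℕ.* r ℕ.+ (1 ℕ.* 2) ℕ.* x ≡ 2 ℕ.* r ℕ.+ 2 ℕ.* x
      shape = solve-∀

    JI : ∀ m → Mat (2 ^ suc (suc m) ℕ.* 2) (1 ℕ.* 2)
    JI m = J (2 ^ suc (suc m)) 1 ⊗ I 2

    JI-01 : ∀ m → Is01 (JI m)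
    JI-01 m = ⊗-01 (J (2 ^ suc (suc m)) 1) (I 2) J-01 I-01

    RowOnes-JI : ∀ m → RowOnes (JI m) 1
    RowOnes-JI m = RowOnes-⊗ (RowOnes-J (2 ^ suc (suc m)) 1) (RowOnes-I 2) (inj₁ J-01)

    ColOnes-JI : ∀ m → ColOnes (JI m) (2 ^ suc (suc m) ℕ.* 1)
    ColOnes-JI m = ColOnes-⊗ (ColOnes-J (2 ^ suc (suc m)) 1) (ColOnes-I 2) (inj₁ J-01)

    TopColOnes-JI : ∀ m → TopColOnes 2 (JI m) 1
    TopColOnes-JI m =
      TopColOnes-⊗ 1 refl (TopColOnes-J (2 ^ suc (suc m)) 1 (ℕP.m^n>0 2 (suc (suc m)))) (ColOnes-I 2) (inj₁ J-01)

  RowOnes-B-suc : ∀ m → RowOnes (B m) (t ℕ.* 2 ^ suc m) → RowOnes (B (suc m)) (t ℕ.* 2 ^ suc (suc m))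
  RowOnes-B-suc m rows = subst (RowOnes (B (suc m))) (shape t (2 ^ suc m))
    (RowOnes-cast (B-rows m) (B-cols m) (RowOnes-vstack
      (RowOnes-⊗ (RowOnes-⊗ (RowOnes-K 2) rows (inj₁ K-01)) (RowOnes-J 1 2) (inj₂ J-01))
      (RowOnes-⊗ (RowOnes-⊗ (RowOnes-I 2) (RowOnes-P t (suc m)) (inj₁ I-01)) (RowOnes-J 1 2) (inj₂ J-01))))
    where
    shape : ∀ t x → (1 ℕ.* (t ℕ.* x)) ℕ.* 2 ≡ t ℕ.* (2 ℕ.* x)
    shape = solve-∀

  ColOnes-B-suc : ∀ m → ColOnes (B m) (κ m) → ColOnes (B (suc m)) (κ (suc m))
  ColOnes-B-suc m cols = subst (ColOnes (B (suc m))) (shape (κ m) (t ℕ.* 2 ^ suc m))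
    (ColOnes-cast (B-rows m) (B-cols m) (ColOnes-vstack
      (ColOnes-⊗ (ColOnes-⊗ (ColOnes-K 2) cols (inj₁ K-01)) (ColOnes-J 1 2) (inj₂ J-01))
      (ColOnes-⊗ (ColOnes-⊗ (ColOnes-I 2) (ColOnes-P t (suc m)) (inj₁ I-01)) (ColOnes-J 1 2) (inj₂ J-01))))
    where
    shape : ∀ x y → (1 ℕ.* x) ℕ.* 1 ℕ.+ (1 ℕ.* y) ℕ.* 1 ≡ x ℕ.+ y
    shape = solve-∀

  module _ (m : ℕ) where
    private instance
      2^suc-nonZero : ℕ.NonZero (2 ^ suc m)
      2^suc-nonZero = ℕP.m^n≢0 2 (suc m)

    RowOnes-C-suc : RowOnes (C m) (κ m) → RowOnes (C (suc m)) (κ (suc m))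
    RowOnes-C-suc rows = subst (RowOnes (C (suc m))) (shape (κ m) (t ℕ.* 2 ^ suc m))
      (RowOnes-cast (C-rows m) (C-cols m) (RowOnes-hstack
        (RowOnes-⊗ (RowOnes-JI m) (RowOnes-α _ _ (αeq (suc m)) rows) (inj₁ (JI-01 m)))
        (RowOnes-⊗ (RowOnes-JI m) (RowOnes-α _ _ (αeq (suc m)) (RowOnes-P t (suc m))) (inj₁ (JI-01 m)))))
      where
      shape : ∀ x y → 1 ℕ.* x ℕ.+ 1 ℕ.* y ≡ x ℕ.+ y
      shape = solve-∀

    ColOnes-C-suc : TopColOnes (t ℕ.* 2 ^ suc m) (C m) t → ColOnes (C (suc m)) (t ℕ.* 2 ^ suc (suc m))
    ColOnes-C-suc top = subst (ColOnes (C (suc m))) (shape (2 ^ suc (suc m)) t)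
      (ColOnes-cast (C-rows m) (C-cols m) (ColOnes-hstack
        (ColOnes-⊗ (ColOnes-JI m) (ColOnes-α _ _ (αeq (suc m)) top) (inj₁ (JI-01 m)))
        (ColOnes-⊗ (ColOnes-JI m) (ColOnes-α _ _ (αeq (suc m)) (TopColOnes-P t (suc m))) (inj₁ (JI-01 m)))))
      where
      shape : ∀ a t → (a ℕ.* 1) ℕ.* t ≡ t ℕ.* a
      shape = solve-∀

    TopColOnes-C-suc : TopColOnes (t ℕ.* 2 ^ suc m) (C m) t →
                     TopColOnes (t ℕ.* 2 ^ suc (suc m)) (C (suc m)) t
    TopColOnes-C-suc top = subst (TopColOnes _ (C (suc m))) (ℕP.*-identityˡ t)
      (TopColOnes-cast (C-rows m) (C-cols m) _ (TopColOnes-hstack _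
        (TopColOnes-⊗ 2 (shape t (2 ^ suc m)) (TopColOnes-JI m) (ColOnes-α _ _ (αeq (suc m)) top) (inj₁ (JI-01 m)))
        (TopColOnes-⊗ 2 (shape t (2 ^ suc m)) (TopColOnes-JI m)
          (ColOnes-α _ _ (αeq (suc m)) (TopColOnes-P t (suc m))) (inj₁ (JI-01 m)))))
      where
      shape : ∀ t x → 2 ℕ.* (t ℕ.* x) ≡ t ℕ.* (2 ℕ.* x)
      shape = solve-∀

  record Degrees (m : ℕ) : Set where
    field
      rows-B : RowOnes (B m) (t ℕ.* 2 ^ suc m)
      cols-B : ColOnes (B m) (κ m)
      rows-C : RowOnes (C m) (κ m)
      cols-C : ColOnes (C m) (t ℕ.* 2 ^ suc m)
      top-C  : TopColOnes (t ℕ.* 2 ^ suc m) (C m) t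

  degrees : Degrees zero → ∀ m → Degrees m
  degrees d₀ zero    = d₀
  degrees d₀ (suc m) = record
    { rows-B = RowOnes-B-suc m rows-B
    ; cols-B = ColOnes-B-suc m cols-B
    ; rows-C = RowOnes-C-suc m rows-C
    ; cols-C = ColOnes-C-suc m top-C
    ; top-C  = TopColOnes-C-suc m top-C
    }
    where open Degrees (degrees d₀ m)

  +κ : ∀ m → + κ m ≡ + c + (+ (2 ^ suc m) - + 2) * + t
  +κ zero    = sym (ℤP.+-identityʳ (+ c))
  +κ (suc m) = begin
    + κ m + + (t ℕ.* 2 ^ suc m)
      ≡⟨ cong₂ _+_ (+κ m) (ℤP.pos-* t (2 ^ suc m)) ⟩
    + c + (+ (2 ^ suc m) - + 2) * + t + + t * + (2 ^ suc m)
      ≡⟨ doubling (+ c) (+ (2 ^ suc m)) (+ t) ⟩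
    + c + (+ 2 * + (2 ^ suc m) - + 2) * + t
      ≡⟨ cong (λ x → + c + (x - + 2) * + t) (ℤP.pos-* 2 (2 ^ suc m)) ⟨
    + c + (+ (2 ^ suc (suc m)) - + 2) * + t
      ∎
    where
    open ≡-Reasoning
    doubling : ∀ c a t → c + (a - + 2) * t + t * a ≡ c + (+ 2 * a - + 2) * t
    doubling = ℤ-Solver.solve-∀

lemma3 : (v : ℕ) (k : ℤ) (t : ℕ) (lam : ℤ) → 1 ≤ t →
  (A₁ : Mat v v) → IsSRD v k (+ t) lam (+ t) A₁ →
  (B₁ : Mat v (t *ℕ 4 ^ 1)) (C₁ : Mat (t *ℕ 4 ^ 1) v) →
  Is01 B₁ → Is01 C₁ →
  B₁ ⊛ C₁ ≐ + t · J v v →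
  B₁ ⊛ P t 1 ≐ + t · J v (t *ℕ 4 ^ 1) →
  P t 1 ⊛ C₁ ≐ + t · J (t *ℕ 4 ^ 1) v →
  A₁ ⊛ B₁ ⊕ (+ t - lam) · B₁ ≐ + t · J v (t *ℕ 4 ^ 1) →
  C₁ ⊛ A₁ ⊕ (+ t - lam) · C₁ ≐ + t · J (t *ℕ 4 ^ 1) v →
  C₁ ⊛ B₁ ⊕ (+ t - lam) · P t 1 ≐ + t · J (t *ℕ 4 ^ 1) (t *ℕ 4 ^ 1) →
  B₁ ⊛ J (t *ℕ 4 ^ 1) (t *ℕ 4 ^ 1) ≐ + (2 *ℕ t) · J v (t *ℕ 4 ^ 1) →
  J v v ⊛ B₁ ≐ k · J v (t *ℕ 4 ^ 1) →
  C₁ ⊛ J v v ≐ k · J (t *ℕ 4 ^ 1) v →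
  J (t *ℕ 4 ^ 1) (t *ℕ 4 ^ 1) ⊛ C₁ ≐ + (2 *ℕ t) · J (t *ℕ 4 ^ 1) v →
  (∀ i → ((∀ j → toℕ j < 2 *ℕ t → B₁ i j ≡ + 1) × (∀ j → 2 *ℕ t ≤ toℕ j → B₁ i j ≡ + 0))
       ⊎ ((∀ j → toℕ j < 2 *ℕ t → B₁ i j ≡ + 0) × (∀ j → 2 *ℕ t ≤ toℕ j → B₁ i j ≡ + 1))) →
  (∀ j → (count (λ i → (toℕ i <ᵇ 2 *ℕ t) ∧ isOne (C₁ i j)) ≡ t)
       × (count (λ i → not (toℕ i <ᵇ 2 *ℕ t) ∧ isOne (C₁ i j)) ≡ t)) →
  ∀ m →
    (∀ i → onesInRow (Construction.B v t B₁ C₁ m) i ≡ t *ℕ 2 ^ suc m)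
  × (∀ j → + onesInCol (Construction.B v t B₁ C₁ m) j ≡ k + (+ (2 ^ suc m) - + 2) * + t)
  × (∀ i → + onesInRow (Construction.C v t B₁ C₁ m) i ≡ k + (+ (2 ^ suc m) - + 2) * + t)
  × (∀ j → onesInCol (Construction.C v t B₁ C₁ m) j ≡ t *ℕ 2 ^ suc m)
-- Besides the 0-1 property, only the products with J and the top halves in (ii) are
-- used; C₁B₁ + sP₁ = tJ serves to rule out v = 0.
lemma3 v k t lam 1≤t _ _ B₁ C₁ B₁-01 C₁-01 _ _ _ _ _ CB+sP≐tJ BJ≐2tJ JB≐kJ CJ≐kJ JC≐2tJ _ topHalves m =
  onesInRow≡ rows-B , colsB , rowsC , onesInCol≡ cols-C
  where
  i₀ : Fin v
  i₀ = someVertex (+ t - lam) C₁ B₁ 1≤t CB+sP≐tJ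
  j₀ : Fin (t *ℕ 4 ^ 1)
  j₀ = Fin.fromℕ< (ℕP.≤-trans 1≤t (ℕP.m≤m*n t 4))
  colsB₁ : ∀ j → + onesInCol B₁ j ≡ k
  colsB₁ = onesInCol-J⊛ B₁ B₁-01 JB≐kJ i₀
  rowsC₁ : ∀ i → + onesInRow C₁ i ≡ k
  rowsC₁ = onesInRow-⊛J C₁ C₁-01 CJ≐kJ i₀
  open Growth v t B₁ C₁ (onesInCol B₁ j₀)
  base : Degrees zero
  base = record
    { rows-B = rowOnes λ i →
        ℤP.+-injective (trans (onesInRow-⊛J B₁ B₁-01 BJ≐2tJ j₀ i) (cong +_ (ℕP.*-comm 2 t)))
    ; cols-B = colOnes λ j → ℤP.+-injective (trans (colsB₁ j) (sym (colsB₁ j₀)))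
    ; rows-C = rowOnes λ i → ℤP.+-injective (trans (rowsC₁ i) (sym (colsB₁ j₀)))
    ; cols-C = colOnes λ j →
        ℤP.+-injective (trans (onesInCol-J⊛ C₁ C₁-01 JC≐2tJ j₀ j) (cong +_ (ℕP.*-comm 2 t)))
    ; top-C  = topColOnes λ j → trans (cong (λ d → onesInTop d C₁ j) (ℕP.*-comm t 2)) (proj₁ (topHalves j))
    }
  open Degrees (degrees base m)
  closed-form : + κ m ≡ k + (+ (2 ^ suc m) - + 2) * + t
  closed-form = trans (+κ m) (cong (_+ (+ (2 ^ suc m) - + 2) * + t) (colsB₁ j₀))
  colsB : ∀ j → + onesInCol (Construction.B v t B₁ C₁ m) j ≡ k + (+ (2 ^ suc m) - + 2) * + t
  colsB = λ j → trans (cong +_ (onesInCol≡ cols-B j)) closed-form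
  rowsC : ∀ i → + onesInRow (Construction.C v t B₁ C₁ m) i ≡ k + (+ (2 ^ suc m) - + 2) * + t
  rowsC = λ i → trans (cong +_ (onesInRow≡ rows-C i)) closed-form
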